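{- Let $G$ be a $d$-regular graph with balancing graph $G^+$. There exist an initial distribution of tokens and a round-fair balancer $A$ such that $A$ cannot achieve a discrepancy better than $c\cdot \operatorname{diam}(G)\cdot d$, for some positive constant $c>0$; that is, at every time step the discrepancy is at least $c\cdot\operatorname{diam}(G)\cdot d$.
   Context: Model: $G=(V,E)$ is a $d$-regular graph viewed as a symmetric directed graph; $G^+$ is obtained by adding $d^{\circ}$ self-loops at each node, $d^+=d+d^{\circ}$; $E_u^+$ denotes the original edges out of $u$ together with its self-loops. $x_t(u)$ is the number of indivisible tokens at $u$ at the beginning of synchronous step $t$; in each step every node sends all its tokens over the edges of $E_u^+$ and its new load is the number of tokens arriving to it. The discrepancy is $\max_u x_t(u)-\min_u x_t(u)$. A balancer is round-fair if in every step $t$ every node $u$ sends either $\lfloor x_t(u)/d^+\rfloor$ or $\lceil x_t(u)/d^+\rceil$ tokens over each edge of $E_u^+$. $\operatorname{diam}(G)$ is the diameter of $G$. -}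

module Defs where

open import Data.Nat using (ℕ; zero; suc; _+_; _*_; _∸_; _⊔_; _⊓_; _<_; _≤_; NonZero)
open import Data.Nat.DivMod using (_/_)
open import Data.Fin using (Fin; zero; suc)
open import Data.Bool using (Bool; true; false; if_then_else_)
open import Data.Product using (Σ; _×_; ∃; ∃-syntax)
open import Data.Sum using (_⊎_)
open import Relation.Binary.PropositionalEquality using (_≡_)
open import Relation.Nullary using (¬_)

Adj : ℕ → Set
Adj m = Fin m → Fin m → Bool

sumF : ∀ {m} → (Fin m → ℕ) → ℕ
sumF {zero} f = 0
sumF {suc m} f = f zero + sumF (λ i → f (suc i))

maxF : ∀ {n} → (Fin (suc n) → ℕ) → ℕ
maxF {zero} f = f zero
maxF {suc n} f = f zero ⊔ maxF (λ i → f (suc i))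

minF : ∀ {n} → (Fin (suc n) → ℕ) → ℕ
minF {zero} f = f zero
minF {suc n} f = f zero ⊓ minF (λ i → f (suc i))

discrepancy : ∀ {n} → (Fin (suc n) → ℕ) → ℕ
discrepancy x = maxF x ∸ minF x

IsSimple : ∀ {m} → Adj m → Set
IsSimple {m} adj = (∀ u v → adj u v ≡ adj v u) × (∀ u → adj u u ≡ false)

degree : ∀ {m} → Adj m → Fin m → ℕ
degree adj u = sumF (λ v → if adj u v then 1 else 0)

IsRegular : ∀ {m} → Adj m → ℕ → Set
IsRegular adj d = ∀ u → degree adj u ≡ d

data Walk {m} (adj : Adj m) : Fin m → Fin m → ℕ → Set where
  here : ∀ {u} → Walk adj u u 0
  step : ∀ {u w v ℓ} → adj u w ≡ true → Walk adj w v ℓ → Walk adj u v (suc ℓ)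

DistLe : ∀ {m} → Adj m → Fin m → Fin m → ℕ → Set
DistLe adj u v D = ∃[ ℓ ] (ℓ ≤ D × Walk adj u v ℓ)

IsDiameter : ∀ {m} → Adj m → ℕ → Set
IsDiameter adj D =
  (∀ u v → DistLe adj u v D) ×
  (∃[ u ] ∃[ v ] (∀ ℓ → ℓ < D → ¬ Walk adj u v ℓ))

floorDiv : (x D : ℕ) → .{{NonZero D}} → ℕ
floorDiv x D = x / D

ceilDiv : (x D : ℕ) → .{{NonZero D}} → ℕ
ceilDiv x D = (x + (D ∸ 1)) / D

RoundFairAmount : (x D : ℕ) → .{{NonZero D}} → ℕ → Set
RoundFairAmount x D y = (y ≡ floorDiv x D) ⊎ (y ≡ ceilDiv x D)

-- An execution of a (possibly history-dependent) round-fair balancer on G⁺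
-- (G with dˡ self-loops per node, d⁺ = d + dˡ):
--   x t u      : load of u at the beginning of step t
--   f t u v    : tokens sent by u over the original edge (u,v) in step t (used only if adj u v)
--   s t u i    : tokens sent by u over its i-th self-loop in step t
record RoundFairExecution {n} (adj : Adj (suc n)) (d dˡ : ℕ) .{{_ : NonZero (d + dˡ)}}
                          (x : ℕ → Fin (suc n) → ℕ) : Set where
  field
    f : ℕ → Fin (suc n) → Fin (suc n) → ℕ
    s : ℕ → Fin (suc n) → Fin dˡ → ℕ
    fair-edge : ∀ t u v → adj u v ≡ true → RoundFairAmount (x t u) (d + dˡ) (f t u v)
    fair-loop : ∀ t u i → RoundFairAmount (x t u) (d + dˡ) (s t u i)
    send-all  : ∀ t u → sumF (λ v → if adj u v then f t u v else 0) + sumF (s t u) ≡ x t u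
    arrive    : ∀ t v → x (suc t) v ≡ sumF (λ u → if adj u v then f t u v else 0) + sumF (s t v)

module Submission where

-- Fix two vertices `far` and `centre` at distance exactly D = diam(G).  Let
-- q v = D ∸ dist(v, centre) be the truncated distance potential; adjacent
-- vertices differ in q by at most one.  Put  q v · d⁺ + up v  tokens on v,
-- where up v counts the neighbours one level above v, and let every node send
-- q v tokens over each self-loop and over each edge, plus one extra token over
-- every edge leading one level up.  Every amount is ⌊x/d⁺⌋ or ⌈x/d⁺⌉, and each
-- node receives exactly what it sent, so this load vector is stationary.  Its
-- discrepancy is at least load(centre) ∸ load(far) ≥ d⁺·D ∸ d, which is at
-- least D·d/2 whenever d ≤ 2(d⁺ ∸ 1).  The single exception d = 1, d⁺ = 1 is a
-- perfect matching; there one token oscillating along an edge keeps the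
-- discrepancy at 1 = diam(G)·d.  Hence the theorem holds with constant 1/2.

open import Defs
open import Data.Nat using (ℕ; zero; suc; _+_; _*_; _∸_; _≤_; _<_; z≤n; s≤s; NonZero; _≟_)
open import Data.Nat.Properties
open import Data.Nat.DivMod using (_/_; +-distrib-/-∣ˡ; m*n/n≡m; m<n⇒m/n≡0; n/1≡n)
open import Data.Nat.Divisibility using (n∣m*n)
open import Data.Nat.Tactic.RingSolver using (solve-∀)
open import Data.Bool using (Bool; true; false; if_then_else_)
import Data.Bool as Bool
open import Data.Fin using (Fin; zero; suc)
import Data.Fin as Fin
open import Data.Fin.Properties using (any?) renaming (suc-injective to fsuc-injective)
open import Data.Product using (_×_; _,_; proj₁; proj₂; ∃-syntax)
open import Data.Sum using (_⊎_; inj₁; inj₂)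
open import Data.Empty using (⊥-elim)
open import Relation.Nullary using (¬_; Dec; yes; no; does)
open import Relation.Nullary.Decidable using (dec-true; dec-false; map′; _⊎-dec_; _×-dec_)
open import Relation.Binary.PropositionalEquality

indicator : Bool → ℕ
indicator b = if b then 1 else 0

indicator≤1 : ∀ b → indicator b ≤ 1
indicator≤1 true  = ≤-refl
indicator≤1 false = z≤n

sumF-cong : ∀ {m} {f g : Fin m → ℕ} → (∀ i → f i ≡ g i) → sumF f ≡ sumF g
sumF-cong {zero}  h = refl
sumF-cong {suc m} h = cong₂ _+_ (h zero) (sumF-cong (λ i → h (suc i)))

sumF-+ : ∀ {m} (f g : Fin m → ℕ) → sumF (λ i → f i + g i) ≡ sumF f + sumF g
sumF-+ {zero}  f g = refl
sumF-+ {suc m} f g = begin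
  f zero + g zero + sumF (λ i → f (suc i) + g (suc i))
    ≡⟨ cong (f zero + g zero +_) (sumF-+ (λ i → f (suc i)) (λ i → g (suc i))) ⟩
  f zero + g zero + (sumF (λ i → f (suc i)) + sumF (λ i → g (suc i)))
    ≡⟨ +-shuffle (f zero) (g zero) _ _ ⟩
  f zero + sumF (λ i → f (suc i)) + (g zero + sumF (λ i → g (suc i)))  ∎
  where
  open ≡-Reasoning
  +-shuffle : ∀ a b c d → a + b + (c + d) ≡ a + c + (b + d)
  +-shuffle = solve-∀

sumF-const : ∀ {m} (c : ℕ) → sumF {m} (λ _ → c) ≡ m * c
sumF-const {zero}  c = refl
sumF-const {suc m} c = cong (c +_) (sumF-const {m} c)

sumF-indicator : ∀ {m} (b : Fin m → Bool) (c : ℕ) →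
                 sumF (λ i → if b i then c else 0) ≡ c * sumF (λ i → indicator (b i))
sumF-indicator {zero}  b c = sym (*-zeroʳ c)
sumF-indicator {suc m} b c with b zero
... | true  = trans (cong (c +_) (sumF-indicator (λ i → b (suc i)) c)) (sym (*-suc c _))
... | false = sumF-indicator (λ i → b (suc i)) c

sumF-mono : ∀ {m} {f g : Fin m → ℕ} → (∀ i → f i ≤ g i) → sumF f ≤ sumF g
sumF-mono {zero}  h = z≤n
sumF-mono {suc m} h = +-mono-≤ (h zero) (sumF-mono (λ i → h (suc i)))

sumF-mono-< : ∀ {m} {f g : Fin m → ℕ} → (∀ i → f i ≤ g i) →
              (j : Fin m) → f j < g j → sumF f < sumF g
sumF-mono-< h zero    lt = +-mono-<-≤ lt (sumF-mono (λ i → h (suc i)))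
sumF-mono-< h (suc j) lt = +-mono-≤-< (h zero) (sumF-mono-< (λ i → h (suc i)) j lt)

sumF-term : ∀ {m} (f : Fin m → ℕ) (i : Fin m) → f i ≤ sumF f
sumF-term f zero    = m≤m+n _ _
sumF-term f (suc i) = ≤-trans (sumF-term (λ j → f (suc j)) i) (m≤n+m _ _)

sumF-two-terms : ∀ {m} (f : Fin m → ℕ) (i j : Fin m) → i ≢ j → f i + f j ≤ sumF f
sumF-two-terms f zero    zero    i≢j = ⊥-elim (i≢j refl)
sumF-two-terms f zero    (suc j) i≢j = +-monoʳ-≤ (f zero) (sumF-term (λ k → f (suc k)) j)
sumF-two-terms f (suc i) zero    i≢j =
  subst (_≤ sumF f) (+-comm (f zero) _) (+-monoʳ-≤ (f zero) (sumF-term (λ k → f (suc k)) i))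
sumF-two-terms f (suc i) (suc j) i≢j =
  ≤-trans (sumF-two-terms (λ k → f (suc k)) i j (λ i≡j → i≢j (cong suc i≡j))) (m≤n+m _ _)

sumF-zero : ∀ {m} (f : Fin m → ℕ) → (∀ i → f i ≡ 0) → sumF f ≡ 0
sumF-zero {zero}  f h = refl
sumF-zero {suc m} f h = cong₂ _+_ (h zero) (sumF-zero (λ i → f (suc i)) (λ i → h (suc i)))

sumF-single : ∀ {m} (f : Fin m → ℕ) (a : Fin m) → (∀ i → i ≢ a → f i ≡ 0) → sumF f ≡ f a
sumF-single f zero h =
  trans (cong (f zero +_) (sumF-zero (λ i → f (suc i)) (λ i → h (suc i) (λ ())))) (+-identityʳ _)
sumF-single f (suc a) h =
  trans (cong (_+ sumF (λ i → f (suc i))) (h zero (λ ())))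
        (sumF-single (λ i → f (suc i)) a (λ i i≢a → h (suc i) (λ e → i≢a (fsuc-injective e))))

floor-exact : ∀ D q r .{{_ : NonZero D}} → r < D → floorDiv (q * D + r) D ≡ q
floor-exact D q r r<D = begin
  (q * D + r) / D     ≡⟨ +-distrib-/-∣ˡ r (n∣m*n q) ⟩
  q * D / D + r / D   ≡⟨ cong₂ _+_ (m*n/n≡m q D) (m<n⇒m/n≡0 r<D) ⟩
  q + 0               ≡⟨ +-identityʳ q ⟩
  q                   ∎
  where open ≡-Reasoning

ceil-exact : ∀ D q r .{{_ : NonZero D}} → 1 ≤ r → r ≤ D → ceilDiv (q * D + r) D ≡ suc q
ceil-exact (suc e) q (suc r) _ (s≤s r≤e) =
  trans (cong (_/ suc e) (regroup e q r)) (floor-exact (suc e) (suc q) r (s≤s r≤e))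
  where
  regroup : ∀ e q r → q * suc e + suc r + e ≡ suc q * suc e + r
  regroup = solve-∀

maxF-≥ : ∀ {n} (f : Fin (suc n) → ℕ) i → f i ≤ maxF f
maxF-≥ {zero}  f zero    = ≤-refl
maxF-≥ {suc n} f zero    = m≤m⊔n _ _
maxF-≥ {suc n} f (suc i) = ≤-trans (maxF-≥ (λ j → f (suc j)) i) (m≤n⊔m (f zero) _)

minF-≤ : ∀ {n} (f : Fin (suc n) → ℕ) i → minF f ≤ f i
minF-≤ {zero}  f zero    = ≤-refl
minF-≤ {suc n} f zero    = m⊓n≤m _ _
minF-≤ {suc n} f (suc i) = ≤-trans (m⊓n≤n (f zero) _) (minF-≤ (λ j → f (suc j)) i)

discrepancy-≥ : ∀ {n} (f : Fin (suc n) → ℕ) i j → f i ∸ f j ≤ discrepancy f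
discrepancy-≥ f i j = ∸-mono (maxF-≥ f i) (minF-≤ f j)

lift : ℕ → ℕ → ℕ
lift a b = indicator (does (b ≟ suc a))

lift-yes : ∀ {a b} → b ≡ suc a → lift a b ≡ 1
lift-yes {a} {b} e = cong indicator (dec-true (b ≟ suc a) e)

lift-no : ∀ {a b} → b ≢ suc a → lift a b ≡ 0
lift-no {a} {b} ne = cong indicator (dec-false (b ≟ suc a) ne)

-- Across an edge whose endpoint levels differ by at most one, "own level plus
-- one if the other side is higher" is the same number seen from both sides:
-- this is why every node receives exactly what it sends.
flow-up : ∀ a b → b ≡ suc a → a + lift a b ≡ b + lift b a
flow-up a b b≡ = begin
  a + lift a b  ≡⟨ cong (a +_) (lift-yes b≡) ⟩
  a + 1         ≡⟨ +-comm a 1 ⟩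
  suc a         ≡⟨ sym b≡ ⟩
  b             ≡⟨ sym (+-identityʳ b) ⟩
  b + 0         ≡⟨ cong (b +_) (sym (lift-no (λ a≡ → m≢1+n+m a {1} (trans a≡ (cong suc b≡))))) ⟩
  b + lift b a  ∎
  where open ≡-Reasoning

flow-balance : ∀ a b → a ≤ suc b → b ≤ suc a → a + lift a b ≡ b + lift b a
flow-balance a b a≤ b≤ with b ≟ suc a | a ≟ suc b
... | yes b≡ | _      = flow-up a b b≡
... | no _   | yes a≡ = sym (flow-up b a a≡)
... | no b≢  | no a≢  = begin
  a + lift a b  ≡⟨ cong (a +_) (lift-no b≢) ⟩
  a + 0         ≡⟨ cong (_+ 0) (≤-antisym (≤-pred (≤∧≢⇒< a≤ a≢)) (≤-pred (≤∧≢⇒< b≤ b≢))) ⟩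
  b + 0         ≡⟨ cong (b +_) (sym (lift-no a≢)) ⟩
  b + lift b a  ∎
  where open ≡-Reasoning

-- Given a potential q that changes by at most one along every edge, the load
-- q v · d⁺ + up v is a fixed point of a round-fair balancer: v sends q v over
-- each self-loop and q v + lift (q v) (q w) over each edge (v,w).
module Stationary {n} (d dˡ : ℕ) .{{_ : NonZero (d + dˡ)}} (adj : Adj (suc n))
                  (simple : IsSimple adj) (regular : IsRegular adj d)
                  (q : Fin (suc n) → ℕ)
                  (lipschitz : ∀ u v → adj u v ≡ true → q u ≤ suc (q v)) where

  nbrSum : Fin (suc n) → (Fin (suc n) → ℕ) → ℕ
  nbrSum v g = sumF (λ w → if adj v w then g w else 0)

  nbrSum-const : ∀ v c → nbrSum v (λ _ → c) ≡ c * d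
  nbrSum-const v c = trans (sumF-indicator (adj v) c) (cong (c *_) (regular v))

  nbrSum-+ : ∀ v g h → nbrSum v (λ w → g w + h w) ≡ nbrSum v g + nbrSum v h
  nbrSum-+ v g h = trans (sumF-cong split)
    (sumF-+ (λ w → if adj v w then g w else 0) (λ w → if adj v w then h w else 0))
    where
    split : ∀ w → (if adj v w then g w + h w else 0) ≡
                  (if adj v w then g w else 0) + (if adj v w then h w else 0)
    split w with adj v w
    ... | true  = refl
    ... | false = refl

  up : Fin (suc n) → ℕ
  up v = nbrSum v (λ w → lift (q v) (q w))

  load : Fin (suc n) → ℕ
  load v = q v * (d + dˡ) + up v

  send : Fin (suc n) → Fin (suc n) → ℕ
  send v w = q v + lift (q v) (q w)

  lift≤edge : ∀ v w → (if adj v w then lift (q v) (q w) else 0) ≤ indicator (adj v w)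
  lift≤edge v w with adj v w
  ... | true  = indicator≤1 _
  ... | false = z≤n

  up≤d : ∀ v → up v ≤ d
  up≤d v = subst (up v ≤_) (regular v) (sumF-mono (lift≤edge v))

  up≤d⁺ : ∀ v → up v ≤ d + dˡ
  up≤d⁺ v = ≤-trans (up≤d v) (m≤m+n d dˡ)

  -- An upward edge is counted by up, so ⌈load/d⁺⌉ = q + 1 at its tail ...
  up-positive : ∀ v w → adj v w ≡ true → q w ≡ suc (q v) → 1 ≤ up v
  up-positive v w e higher = subst (_≤ up v) counted (sumF-term (λ w → if adj v w then lift (q v) (q w) else 0) w)
    where
    counted : (if adj v w then lift (q v) (q w) else 0) ≡ 1
    counted rewrite e = lift-yes higher

  -- ... and a non-upward edge is not, so ⌊load/d⁺⌋ = q there.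
  up<d : ∀ v w → adj v w ≡ true → q w ≢ suc (q v) → up v < d
  up<d v w e level = subst (up v <_) (regular v) (sumF-mono-< (lift≤edge v) w strict)
    where
    strict : (if adj v w then lift (q v) (q w) else 0) < indicator (adj v w)
    strict rewrite e | lift-no level = s≤s z≤n

  floor-load : ∀ v → up v < d + dˡ → floorDiv (load v) (d + dˡ) ≡ q v
  floor-load v = floor-exact (d + dˡ) (q v) (up v)

  fair-edge : ∀ v w → adj v w ≡ true → RoundFairAmount (load v) (d + dˡ) (send v w)
  fair-edge v w e with q w ≟ suc (q v)
  ... | yes higher = inj₂ (begin
          q v + lift (q v) (q w)      ≡⟨ cong (q v +_) (lift-yes higher) ⟩
          q v + 1                     ≡⟨ +-comm (q v) 1 ⟩
          suc (q v)                   ≡⟨ sym (ceil-exact (d + dˡ) (q v) (up v) (up-positive v w e higher) (up≤d⁺ v)) ⟩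
          ceilDiv (load v) (d + dˡ)   ∎)
    where open ≡-Reasoning
  ... | no level = inj₁ (trans (cong (q v +_) (lift-no level))
                        (trans (+-identityʳ (q v))
                               (sym (floor-load v (<-≤-trans (up<d v w e level) (m≤m+n d dˡ))))))

  -- A self-loop exists only if dˡ > 0, and then up ≤ d < d⁺.
  fair-loop : ∀ v (i : Fin dˡ) → RoundFairAmount (load v) (d + dˡ) (q v)
  fair-loop v i = inj₁ (sym (floor-load v (≤-<-trans (up≤d v) (m<m+n d (loop-count i)))))
    where
    loop-count : Fin dˡ → 0 < dˡ
    loop-count zero    = s≤s z≤n
    loop-count (suc _) = s≤s z≤n

  -- What v sends (equivalently, by flow-balance, receives) adds up to load v.
  outflow : ∀ v → nbrSum v (send v) + sumF {dˡ} (λ _ → q v) ≡ load v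
  outflow v = begin
    nbrSum v (send v) + sumF {dˡ} (λ _ → q v)
      ≡⟨ cong₂ _+_ (nbrSum-+ v (λ _ → q v) (λ w → lift (q v) (q w))) (sumF-const {dˡ} (q v)) ⟩
    nbrSum v (λ _ → q v) + up v + dˡ * q v
      ≡⟨ cong (λ s → s + up v + dˡ * q v) (nbrSum-const v (q v)) ⟩
    q v * d + up v + dˡ * q v
      ≡⟨ regroup (q v) d dˡ (up v) ⟩
    load v  ∎
    where
    open ≡-Reasoning
    regroup : ∀ q d l u → q * d + u + l * q ≡ q * (d + l) + u
    regroup = solve-∀

  inflow : ∀ v → load v ≡ sumF (λ u → if adj u v then send u v else 0) + sumF {dˡ} (λ _ → q v)
  inflow v = sym (trans (cong (_+ sumF {dˡ} (λ _ → q v)) (sumF-cong incoming)) (outflow v))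
    where
    incoming : ∀ u → (if adj u v then send u v else 0) ≡ (if adj v u then send v u else 0)
    incoming u rewrite proj₁ simple u v with adj v u in e
    ... | true  = flow-balance (q u) (q v) (lipschitz u v (trans (proj₁ simple u v) e)) (lipschitz v u e)
    ... | false = refl

  execution : RoundFairExecution adj d dˡ (λ _ → load)
  execution = record
    { f         = λ _ → send
    ; s         = λ _ v _ → q v
    ; fair-edge = λ _ → fair-edge
    ; fair-loop = λ _ → fair-loop
    ; send-all  = λ _ → outflow
    ; arrive    = λ _ → inflow
    }

count : {P : ℕ → Set} → (∀ ℓ → Dec (P ℓ)) → ℕ → ℕ
count P? zero    = 0
count P? (suc D) = indicator (does (P? D)) + count P? D

module _ {P Q : ℕ → Set} (P? : ∀ ℓ → Dec (P ℓ)) (Q? : ∀ ℓ → Dec (Q ℓ)) where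

  count-mono : (∀ ℓ → P ℓ → Q ℓ) → ∀ D → count P? D ≤ count Q? D
  count-mono P⇒Q zero = z≤n
  count-mono P⇒Q (suc D) with P? D | Q? D
  ... | yes p | yes _ = s≤s (count-mono P⇒Q D)
  ... | yes p | no ¬q = ⊥-elim (¬q (P⇒Q D p))
  ... | no _  | yes _ = m≤n⇒m≤1+n (count-mono P⇒Q D)
  ... | no _  | no _  = count-mono P⇒Q D

module _ {P : ℕ → Set} (P? : ∀ ℓ → Dec (P ℓ)) where

  count-all : (∀ ℓ → P ℓ) → ∀ D → count P? D ≡ D
  count-all all zero = refl
  count-all all (suc D) rewrite dec-true (P? D) (all D) = cong suc (count-all all D)

  count-none : ∀ D → (∀ ℓ → ℓ < D → ¬ P ℓ) → count P? D ≡ 0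
  count-none zero    none = refl
  count-none (suc D) none rewrite dec-false (P? D) (none D ≤-refl) =
    count-none D (λ ℓ ℓ<D → none ℓ (m≤n⇒m≤1+n ℓ<D))

  count-step : ∀ D → count P? (suc D) ≤ suc (count P? D)
  count-step D = +-monoˡ-≤ (count P? D) (indicator≤1 _)

  count-shift : ∀ D → count (λ ℓ → P? (suc ℓ)) D ≤ suc (count P? D)
  count-shift D = ≤-trans (shifted D) (count-step D)
    where
    shifted : ∀ D → count (λ ℓ → P? (suc ℓ)) D ≤ count P? (suc D)
    shifted zero    = z≤n
    shifted (suc D) = +-monoʳ-≤ _ (shifted D)

  count-one : count P? 1 ≡ 1 → P 0
  count-one c with P? 0
  ... | yes p = p
  ... | no _  = ⊥-elim (0≢1+n c)

module Potential {n} (adj : Adj (suc n)) (simple : IsSimple adj) (centre : Fin (suc n)) where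

  Reaches : ℕ → Fin (suc n) → Set
  Reaches ℓ v = ∃[ k ] (k ≤ ℓ × Walk adj v centre k)

  reaches-centre : ∀ ℓ → Reaches ℓ centre
  reaches-centre ℓ = 0 , z≤n , here

  reaches-step : ∀ {ℓ v w} → adj v w ≡ true → Reaches ℓ w → Reaches (suc ℓ) v
  reaches-step e (k , k≤ℓ , walk) = suc k , s≤s k≤ℓ , step e walk

  -- The ball of radius ℓ + 1 is the centre together with the neighbours of the
  -- ball of radius ℓ; this makes membership decidable.
  reaches? : ∀ ℓ v → Dec (Reaches ℓ v)
  reaches? zero v = map′ (λ { refl → reaches-centre 0 }) (λ { (zero , _ , here) → refl }) (v Fin.≟ centre)
  reaches? (suc ℓ) v = map′ join split
    ((v Fin.≟ centre) ⊎-dec any? (λ w → (adj v w Bool.≟ true) ×-dec reaches? ℓ w))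
    where
    join : v ≡ centre ⊎ ∃[ w ] (adj v w ≡ true × Reaches ℓ w) → Reaches (suc ℓ) v
    join (inj₁ refl)         = reaches-centre (suc ℓ)
    join (inj₂ (_ , e , r)) = reaches-step e r
    split : Reaches (suc ℓ) v → v ≡ centre ⊎ ∃[ w ] (adj v w ≡ true × Reaches ℓ w)
    split (zero , _ , here)                  = inj₁ refl
    split (suc k , s≤s k≤ℓ , step e walk) = inj₂ (_ , e , k , k≤ℓ , walk)

  -- potential D v = #{ℓ < D : dist(v, centre) ≤ ℓ} = D ∸ dist(v, centre).
  potential : ℕ → Fin (suc n) → ℕ
  potential D v = count (λ ℓ → reaches? ℓ v) D

  potential-centre : ∀ D → potential D centre ≡ D
  potential-centre = count-all (λ ℓ → reaches? ℓ centre) reaches-centre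

  potential-far : ∀ D v → (∀ ℓ → ℓ < D → ¬ Walk adj v centre ℓ) → potential D v ≡ 0
  potential-far D v no-walk = count-none (λ ℓ → reaches? ℓ v) D
    (λ ℓ ℓ<D (k , k≤ℓ , walk) → no-walk k (≤-<-trans k≤ℓ ℓ<D) walk)

  potential-lipschitz : ∀ D u v → adj u v ≡ true → potential D u ≤ suc (potential D v)
  potential-lipschitz D u v e =
    ≤-trans (count-mono (λ ℓ → reaches? ℓ u) (λ ℓ → reaches? (suc ℓ) v)
                        (λ ℓ → reaches-step (trans (proj₁ simple v u) e)) D)
            (count-shift (λ ℓ → reaches? ℓ v) D)

  potential-top : ∀ v → potential 1 v ≡ 1 → v ≡ centre
  potential-top v top with count-one (λ ℓ → reaches? ℓ v) top
  ... | zero , _ , here = refl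

diameter-bound : ∀ D d d⁺ u → d ≤ d⁺ → u ≤ d → (D ≡ 1 → u ≤ 1) → d ≤ 2 * (d⁺ ∸ 1) →
                 D * d ≤ 2 * (d⁺ * D ∸ u)
diameter-bound zero d d⁺ u _ _ _ _ = z≤n
diameter-bound (suc zero) d d⁺ u _ _ u≤1 slack = begin
  1 * d            ≡⟨ +-identityʳ d ⟩
  d                ≤⟨ slack ⟩
  2 * (d⁺ ∸ 1)     ≤⟨ *-monoʳ-≤ 2 (∸-mono (≤-reflexive (sym (*-identityʳ d⁺))) (u≤1 refl)) ⟩
  2 * (d⁺ * 1 ∸ u) ∎
  where open ≤-Reasoning
diameter-bound (suc (suc D)) d d⁺ u d≤d⁺ u≤d _ _ = begin
  suc (suc D) * d               ≤⟨ m≤m+n _ (d * D) ⟩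
  suc (suc D) * d + d * D       ≡⟨ regroup D d ⟩
  2 * (d * suc D)               ≡⟨ cong (2 *_) (sym (m+n∸m≡n d _)) ⟩
  2 * (d + d * suc D ∸ d)       ≡⟨ cong (λ x → 2 * (x ∸ d)) (sym (*-suc d (suc D))) ⟩
  2 * (d * suc (suc D) ∸ d)     ≤⟨ *-monoʳ-≤ 2 (∸-mono (*-monoˡ-≤ (suc (suc D)) d≤d⁺) u≤d) ⟩
  2 * (d⁺ * suc (suc D) ∸ u)    ∎
  where
  open ≤-Reasoning
  regroup : ∀ D d → suc (suc D) * d + d * D ≡ 2 * (d * suc D)
  regroup = solve-∀

rounding-slack : ∀ d dˡ → (d ≡ 1 × dˡ ≡ 0) ⊎ d ≤ 2 * (d + dˡ ∸ 1)
rounding-slack zero          dˡ       = inj₂ z≤n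
rounding-slack (suc zero)    zero     = inj₁ (refl , refl)
rounding-slack (suc zero)    (suc dˡ) = inj₂ (s≤s z≤n)
rounding-slack (suc (suc d)) dˡ       = inj₂ (≤-trans (m≤m+n (2 + d) (d + 2 * dˡ)) (≤-reflexive (regroup d dˡ)))
  where
  regroup : ∀ d l → 2 + d + (d + 2 * l) ≡ 2 * (suc d + l)
  regroup = solve-∀

stationary-lower-bound :
  ∀ {n} d dˡ .{{_ : NonZero (d + dˡ)}} (adj : Adj (suc n)) D →
  IsSimple adj → IsRegular adj d → d ≤ 2 * (d + dˡ ∸ 1) →
  (far centre : Fin (suc n)) → (∀ ℓ → ℓ < D → ¬ Walk adj far centre ℓ) →
  ∃[ x ] (RoundFairExecution adj d dˡ x × (∀ t → D * d ≤ 2 * discrepancy (x t)))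
stationary-lower-bound d dˡ adj D simple regular slack far centre no-walk =
  (λ _ → load) , execution , λ _ → ≤-trans bound (*-monoʳ-≤ 2 (discrepancy-≥ load centre far))
  where
  open Potential adj simple centre
  open Stationary d dˡ adj simple regular (potential D) (potential-lipschitz D)

  q-far : potential D far ≡ 0
  q-far = potential-far D far no-walk

  load-centre : (d + dˡ) * D ≤ load centre
  load-centre = subst (_≤ load centre) (trans (cong (_* (d + dˡ)) (potential-centre D)) (*-comm D _))
                      (m≤m+n _ _)

  load-far : load far ≡ up far
  load-far = cong (_+ up far) (cong (_* (d + dˡ)) q-far)

  -- When D = 1 the only vertex above far is the centre itself.
  up-far : D ≡ 1 → up far ≤ 1
  up-far refl = subst (_≤ 1) (sym (sumF-single _ centre not-centre))
                      (≤-trans (lift≤edge far centre) (indicator≤1 _))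
    where
    not-centre : ∀ w → w ≢ centre → (if adj far w then lift (potential 1 far) (potential 1 w) else 0) ≡ 0
    not-centre w w≢centre with adj far w
    ... | false = refl
    ... | true  = lift-no (λ top → w≢centre (potential-top w (trans top (cong suc q-far))))

  bound : D * d ≤ 2 * (load centre ∸ load far)
  bound = subst (λ y → D * d ≤ 2 * (load centre ∸ y)) (sym load-far)
    (≤-trans (diameter-bound D d (d + dˡ) (up far) (m≤m+n d dˡ) (up≤d far) up-far slack)
             (*-monoʳ-≤ 2 (∸-monoˡ-≤ (up far) load-centre)))

module Matching {n} (adj : Adj (suc n)) (simple : IsSimple adj) (regular : IsRegular adj 1) where

  unique-neighbour : ∀ u a b → adj u a ≡ true → adj u b ≡ true → a ≡ b
  unique-neighbour u a b ea eb with a Fin.≟ b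
  ... | yes a≡b = a≡b
  ... | no a≢b  = ⊥-elim (1+n≰n (subst (2 ≤_) (regular u) two-neighbours))
    where
    two-neighbours : 2 ≤ degree adj u
    two-neighbours = subst (λ s → s ≤ degree adj u)
      (cong₂ _+_ (cong indicator ea) (cong indicator eb))
      (sumF-two-terms (λ v → indicator (adj u v)) a b a≢b)

  walk-ends-near : ∀ {a b ℓ} → Walk adj a b ℓ → b ≡ a ⊎ adj a b ≡ true
  walk-ends-near here = inj₁ refl
  walk-ends-near {a} {b} (step {w = w} e walk) with walk-ends-near walk
  ... | inj₁ refl = inj₂ e
  ... | inj₂ e′   = inj₁ (unique-neighbour w b a e′ (trans (proj₁ simple w a) e))

  module Oscillation (centre : Fin (suc n)) where

    atCentre : Fin (suc n) → ℕ
    atCentre v = indicator (does (v Fin.≟ centre))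

    atPartner : Fin (suc n) → ℕ
    atPartner v = indicator (adj centre v)

    load : ℕ → Fin (suc n) → ℕ
    load zero          = atCentre
    load (suc zero)    = atPartner
    load (suc (suc t)) = load t

    centre-loaded : atCentre centre ≡ 1
    centre-loaded = cong indicator (dec-true (centre Fin.≟ centre) refl)

    to-partner : ∀ v → atPartner v ≡ sumF (λ u → if adj u v then atCentre u else 0)
    to-partner v = sym (trans (sumF-single _ centre off-centre) on-centre)
      where
      off-centre : ∀ u → u ≢ centre → (if adj u v then atCentre u else 0) ≡ 0
      off-centre u u≢centre rewrite dec-false (u Fin.≟ centre) u≢centre with adj u v
      ... | true  = refl
      ... | false = refl
      on-centre : (if adj centre v then atCentre centre else 0) ≡ atPartner v
      on-centre rewrite centre-loaded with adj centre v
      ... | true  = refl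
      ... | false = refl

    to-centre : ∀ v → atCentre v ≡ sumF (λ u → if adj u v then atPartner u else 0)
    to-centre v with v Fin.≟ centre
    ... | yes refl = sym (trans (sumF-cong symmetric) (regular centre))
      where
      symmetric : ∀ u → (if adj u centre then atPartner u else 0) ≡ indicator (adj centre u)
      symmetric u rewrite proj₁ simple u centre with adj centre u
      ... | true  = refl
      ... | false = refl
    ... | no v≢centre = sym (sumF-zero _ nobody)
      where
      nobody : ∀ u → (if adj u v then atPartner u else 0) ≡ 0
      nobody u with adj u v in e₁ | adj centre u in e₂
      ... | true  | true  = ⊥-elim (v≢centre (unique-neighbour u v centre e₁ (trans (proj₁ simple u centre) e₂)))
      ... | true  | false = refl
      ... | false | _     = refl

    execution : RoundFairExecution adj 1 0 load
    execution = record
      { f         = λ t u v → load t u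
      ; s         = λ t u ()
      ; fair-edge = λ t u v e → inj₁ (sym (n/1≡n _))
      ; fair-loop = λ t u ()
      ; send-all  = λ t u → trans (+-identityʳ _)
                            (trans (sumF-indicator (adj u) (load t u))
                                   (trans (cong (load t u *_) (regular u)) (*-identityʳ _)))
      ; arrive    = arrive
      }
      where
      arrive : ∀ t v → load (suc t) v ≡ sumF (λ u → if adj u v then load t u else 0) + 0
      arrive zero          v = trans (to-partner v) (sym (+-identityʳ _))
      arrive (suc zero)    v = trans (to-centre v) (sym (+-identityʳ _))
      arrive (suc (suc t)) v = arrive t v

    always-unbalanced : ∀ partner → adj centre partner ≡ true → ∀ t → 1 ≤ discrepancy (load t)
    always-unbalanced partner e zero = ≤-trans gap (discrepancy-≥ atCentre centre partner)
      where
      partner≢centre : partner ≢ centre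
      partner≢centre refl with trans (sym (proj₂ simple centre)) e
      ... | ()
      gap : 1 ≤ atCentre centre ∸ atCentre partner
      gap rewrite centre-loaded | dec-false (partner Fin.≟ centre) partner≢centre = ≤-refl
    always-unbalanced partner e (suc zero) = ≤-trans gap (discrepancy-≥ atPartner partner centre)
      where
      gap : 1 ≤ atPartner partner ∸ atPartner centre
      gap rewrite e | proj₂ simple centre = ≤-refl
    always-unbalanced partner e (suc (suc t)) = always-unbalanced partner e t

  -- In a perfect matching the diameter is at most one and the oscillation
  -- keeps discrepancy 1.
  matching-lower-bound : ∀ D → IsDiameter adj D →
    ∃[ x ] (RoundFairExecution adj 1 0 x × (∀ t → D * 1 ≤ 2 * discrepancy (x t)))
  matching-lower-bound D (close , far , centre , no-walk) = load , execution , bound D (close far centre) no-walk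
    where
    open Oscillation centre
    bound : ∀ D → DistLe adj far centre D → (∀ ℓ → ℓ < D → ¬ Walk adj far centre ℓ) →
            ∀ t → D * 1 ≤ 2 * discrepancy (load t)
    bound zero _ _ t = z≤n
    bound (suc D) (_ , _ , walk) no-walk′ t with walk-ends-near walk
    ... | inj₁ refl = ⊥-elim (no-walk′ 0 (s≤s z≤n) here)
    bound (suc (suc D)) _ no-walk′ t | inj₂ e = ⊥-elim (no-walk′ 1 (s≤s (s≤s z≤n)) (step e here))
    bound (suc zero) _ no-walk′ t | inj₂ e =
      ≤-trans (always-unbalanced far (trans (proj₁ simple centre far) e) t) (m≤m+n _ _)

theorem3 : ∃[ k ] (∀ (n d dˡ : ℕ) .{{_ : NonZero (d + dˡ)}} (adj : Adj (suc n)) (D : ℕ) →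
    IsSimple adj → IsRegular adj d → IsDiameter adj D →
    ∃[ x ] (RoundFairExecution adj d dˡ x ×
    (∀ t → D * d ≤ suc k * discrepancy (x t))))
theorem3 = 1 , lower-bound
  where
  lower-bound : ∀ (n d dˡ : ℕ) .{{_ : NonZero (d + dˡ)}} (adj : Adj (suc n)) (D : ℕ) →
                IsSimple adj → IsRegular adj d → IsDiameter adj D →
                ∃[ x ] (RoundFairExecution adj d dˡ x × (∀ t → D * d ≤ 2 * discrepancy (x t)))
  lower-bound n d dˡ adj D simple regular diameter@(_ , far , centre , no-walk) with rounding-slack d dˡ
  ... | inj₁ (refl , refl) = Matching.matching-lower-bound adj simple regular D diameter
  ... | inj₂ slack = stationary-lower-bound d dˡ adj D simple regular slack far centre no-walk
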